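{- For integers $k\geq 1$ and $n>k+1$, $\Bigl(\sum_{i=k+1}^{n}\frac{1}{u_i}\Bigr)+\frac{1}{u_{k+1}}+\frac{1}{F_{2n+1}}<\frac{1}{u_k}$.
   Context: $F_n$ denotes the Fibonacci numbers ($F_0=0$, $F_1=1$, $F_n=F_{n-1}+F_{n-2}$), and $u_i=F_{2i}$ for $i\geq 1$. -}

module Defs where

open import Data.Nat using (ℕ; zero; suc; _+_; _*_; _≤_; _<_)
open import Data.Integer using (+_)
open import Data.Rational using (ℚ; _/_; 0ℚ) renaming (_+_ to _+ℚ_)

F : ℕ → ℕ
F zero = 0
F (suc zero) = 1
F (suc (suc n)) = F (suc n) + F n

u : ℕ → ℕ
u i = F (2 * i)

-- reciprocal of a natural number as a rational; only ever applied to
-- positive arguments in the statement (inv 0 = 0 is a junk value)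
inv : ℕ → ℚ
inv zero = 0ℚ
inv (suc m) = + 1 / suc m

sumTo : ℕ → (ℕ → ℚ) → ℚ
sumTo zero f = f zero
sumTo (suc n) f = sumTo n f +ℚ f (suc n)

open import Relation.Nullary using (yes; no)
open import Data.Nat using (_≤?_)

sumFrom : ℕ → ℕ → (ℕ → ℚ) → ℚ
sumFrom a n f = sumTo n (λ j → g j)
  where
  g : ℕ → ℚ
  g j with a ≤? j
  ... | yes _ = f j
  ... | no _ = 0ℚ

-- Write x i = 1 / u i and v i = F (2i+1). Cassini's identity v n ² = u n · u (n+1) + 1
-- makes x convex in the strong sense 3 x (i+1) ≤ x i + x (i+2) (the defect is
-- 3 / (u i · u (i+1) · u (i+2))). Any such sequence satisfies
--   Σ_{i=k+1}^{n} x i + x (k+1) + x n ≤ x k + x (n+1)      (n > k),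
-- by induction on n starting from the convexity inequality at k. Cassini also gives
-- 1 / v n + x (n+1) < x n, and adding this to the bound yields the theorem; the
-- hypothesis n > k + 1 is only used as n ≥ k + 1.

{-# OPTIONS --safe #-}
module Submission where

open import Defs
open import Data.Nat using (ℕ; suc; _+_; _*_; _≤_; _<_)
open import Data.Rational using (ℚ) renaming (_+_ to _+ℚ_; _<_ to _<ℚ_)

open import Function.Base using (_∘_)
open import Data.List.Base using ([]; _∷_)
open import Data.Product.Base using (proj₁; _,_)
open import Data.Empty using (⊥-elim)
open import Relation.Nullary using (yes; no)
open import Relation.Binary.PropositionalEquality
open import Data.Nat using (zero; z≤n; s≤s; _≤?_; _≤′_; ≤′-refl; ≤′-step)
open import Data.Nat.Properties
  using (*-suc; +-comm; ≤-refl; ≤-trans; <⇒≤; <⇒≱; m≤m+n; m<m+n; m≤n⇒m≤1+n; *-monoʳ-≤;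
         ≤⇒≤′; ≤′⇒≤)
import Data.Nat.Properties as ℕ
open import Data.Nat.Tactic.RingSolver using (solve)
open import Data.Integer as ℤ using (+≤+; +<+)
open import Data.Integer.Properties using (pos-*; pos-+)
open import Data.Rational using (0ℚ; -_; toℚᵘ) renaming (_≤_ to _≤ℚ_)
import Data.Rational.Properties as ℚ
open import Data.Rational.Unnormalised using (mkℚᵘ; *≤*; *<*)
  renaming (_+_ to _+ᵘ_; _≃_ to _≃ᵘ_)
import Data.Rational.Unnormalised.Properties as ℚᵘ
open import Algebra.Properties.Group ℚ.+-0-group using (//-rightDividesʳ)
open import Algebra.Solver.CommutativeMonoid ℚ.+-0-commutativeMonoid
  using (_⊕_; _⊜_) renaming (solve to solve-+)

-- p ≐ n / d says p = n / d with d > 0, kept unnormalised so that sums and comparisons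
-- of such witnesses reduce to arithmetic in ℕ.
infix 4 _≐_/_
data _≐_/_ (p : ℚ) (n : ℕ) : ℕ → Set where
  frac : ∀ {d} → toℚᵘ p ≃ᵘ mkℚᵘ (ℤ.+ n) d → p ≐ n / suc d

inv-≐ : ∀ {m} → 0 < m → inv m ≐ 1 / m
inv-≐ {suc m} _ = frac (ℚ.toℚᵘ-fromℚᵘ (mkℚᵘ (ℤ.+ 1) m))

+-≐ : ∀ {p q m n k l} → p ≐ m / n → q ≐ k / l → p +ℚ q ≐ m * l + k * n / (n * l)
+-≐ {p} {q} {m} {suc n} {k} {suc l} (frac p≃) (frac q≃) = frac (begin
  toℚᵘ (p +ℚ q)                       ≈⟨ ℚ.toℚᵘ-homo-+ p q ⟩
  toℚᵘ p +ᵘ toℚᵘ q                    ≈⟨ ℚᵘ.+-cong p≃ q≃ ⟩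
  mkℚᵘ (ℤ.+ m) n +ᵘ mkℚᵘ (ℤ.+ k) l    ≡⟨ cong (λ i → mkℚᵘ i (l + n * suc l)) numerator ⟩
  mkℚᵘ (ℤ.+ (m * suc l + k * suc n)) (l + n * suc l) ∎)
  where
  open ℚᵘ.≃-Reasoning
  numerator : ℤ.+ m ℤ.* ℤ.+ suc l ℤ.+ ℤ.+ k ℤ.* ℤ.+ suc n ≡ ℤ.+ (m * suc l + k * suc n)
  numerator = trans (sym (cong₂ ℤ._+_ (pos-* m (suc l)) (pos-* k (suc n))))
                    (sym (pos-+ (m * suc l) (k * suc n)))

≐-≤ : ∀ {p q m n k l} → p ≐ m / n → q ≐ k / l → m * l ≤ k * n → p ≤ℚ q
≐-≤ {m = m} {suc n} {k} {suc l} (frac p≃) (frac q≃) ml≤kn =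
  ℚ.toℚᵘ-cancel-≤ (ℚᵘ.≤-respˡ-≃ (ℚᵘ.≃-sym p≃) (ℚᵘ.≤-respʳ-≃ (ℚᵘ.≃-sym q≃)
    (*≤* (subst₂ ℤ._≤_ (pos-* m (suc l)) (pos-* k (suc n)) (+≤+ ml≤kn)))))

≐-< : ∀ {p q m n k l} → p ≐ m / n → q ≐ k / l → m * l < k * n → p <ℚ q
≐-< {m = m} {suc n} {k} {suc l} (frac p≃) (frac q≃) ml<kn =
  ℚ.toℚᵘ-cancel-< (ℚᵘ.<-respˡ-≃ (ℚᵘ.≃-sym p≃) (ℚᵘ.<-respʳ-≃ (ℚᵘ.≃-sym q≃)
    (*<* (subst₂ ℤ._<_ (pos-* m (suc l)) (pos-* k (suc n)) (+<+ ml<kn)))))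

inv-convex : ∀ {a c e} → 0 < a → 0 < c → 0 < e → 3 * (a * e) ≤ c * (a + e) →
             inv c +ℚ inv c +ℚ inv c ≤ℚ inv a +ℚ inv e
inv-convex {a} {c} {e} 0<a 0<c 0<e h =
  ≐-≤ (+-≐ (+-≐ (inv-≐ 0<c) (inv-≐ 0<c)) (inv-≐ 0<c)) (+-≐ (inv-≐ 0<a) (inv-≐ 0<e)) (begin
    ((1 * c + 1 * c) * c + 1 * (c * c)) * (a * e)  ≡⟨ solve (a ∷ c ∷ e ∷ []) ⟩
    c * c * (3 * (a * e))                          ≤⟨ *-monoʳ-≤ (c * c) h ⟩
    c * c * (c * (a + e))                          ≡⟨ solve (a ∷ c ∷ e ∷ []) ⟩
    (1 * e + 1 * a) * (c * c * c)                  ∎)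
  where open ℕ.≤-Reasoning

inv-+-inv-< : ∀ {a b c} → 0 < a → 0 < b → 0 < c → a * (b + c) < b * c →
              inv b +ℚ inv c <ℚ inv a
inv-+-inv-< {a} {b} {c} 0<a 0<b 0<c h =
  ≐-< (+-≐ (inv-≐ 0<b) (inv-≐ 0<c)) (inv-≐ 0<a) (begin-strict
    (1 * c + 1 * b) * a  ≡⟨ solve (a ∷ b ∷ c ∷ []) ⟩
    a * (b + c)          <⟨ h ⟩
    b * c                ≡⟨ solve (a ∷ b ∷ c ∷ []) ⟩
    1 * (b * c)          ∎)
  where open ℕ.≤-Reasoning

+-cancelʳ-≤ : ∀ r {p q} → p +ℚ r ≤ℚ q +ℚ r → p ≤ℚ q
+-cancelʳ-≤ r {p} {q} h =
  subst₂ _≤ℚ_ (//-rightDividesʳ r p) (//-rightDividesʳ r q) (ℚ.+-monoˡ-≤ (- r) h)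

+-cancelʳ-< : ∀ r {p q} → p +ℚ r <ℚ q +ℚ r → p <ℚ q
+-cancelʳ-< r {p} {q} h =
  subst₂ _<ℚ_ (//-rightDividesʳ r p) (//-rightDividesʳ r q) (ℚ.+-monoˡ-< (- r) h)

-- sumFrom's summand is local to its where-clause; unification recovers it as a term.
summand : ℕ → ℕ → (ℕ → ℚ) → ℕ → ℚ
summand a n f = proj₁ {B = λ g → sumFrom a n f ≡ sumTo n g} (_ , refl)

summand-≥ : ∀ {a j} n f → a ≤ j → summand a n f j ≡ f j
summand-≥ {a} {j} n f a≤j with a ≤? j
... | yes _   = refl
... | no a≰j = ⊥-elim (a≰j a≤j)

summand-< : ∀ {a j} n f → j < a → summand a n f j ≡ 0ℚ
summand-< {a} {j} n f j<a with a ≤? j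
... | yes a≤j = ⊥-elim (<⇒≱ j<a a≤j)
... | no _    = refl

summand-suc : ∀ a n f j → summand a (suc n) f j ≡ summand a n f j
summand-suc a n f j with a ≤? j
... | yes _ = refl
... | no _  = refl

sumTo-cong : ∀ n {f g} → (∀ j → f j ≡ g j) → sumTo n f ≡ sumTo n g
sumTo-cong zero    f≗g = f≗g zero
sumTo-cong (suc n) f≗g = cong₂ _+ℚ_ (sumTo-cong n f≗g) (f≗g (suc n))

sumFrom-step : ∀ a n f → sumFrom a (suc n) f ≡ sumFrom a n f +ℚ summand a (suc n) f (suc n)
sumFrom-step a n f = cong (_+ℚ summand a (suc n) f (suc n)) (sumTo-cong n (summand-suc a n f))

sumFrom-suc : ∀ {a} n f → a ≤ suc n → sumFrom a (suc n) f ≡ sumFrom a n f +ℚ f (suc n)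
sumFrom-suc {a} n f a≤1+n =
  trans (sumFrom-step a n f) (cong (sumFrom a n f +ℚ_) (summand-≥ (suc n) f a≤1+n))

sumFrom-empty : ∀ {a} n f → n < a → sumFrom a n f ≡ 0ℚ
sumFrom-empty zero        f 0<a   = summand-< zero f 0<a
sumFrom-empty {a} (suc n) f 1+n<a = begin
  sumFrom a (suc n) f                            ≡⟨ sumFrom-step a n f ⟩
  sumFrom a n f +ℚ summand a (suc n) f (suc n)   ≡⟨ cong₂ _+ℚ_ (sumFrom-empty n f (<⇒≤ 1+n<a))
                                                                (summand-< (suc n) f 1+n<a) ⟩
  0ℚ +ℚ 0ℚ                                       ≡⟨ ℚ.+-identityʳ 0ℚ ⟩
  0ℚ                                             ∎
  where open ≡-Reasoning

sumFrom-single : ∀ a f → sumFrom (suc a) (suc a) f ≡ f (suc a)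
sumFrom-single a f = begin
  sumFrom (suc a) (suc a) f         ≡⟨ sumFrom-suc a f ≤-refl ⟩
  sumFrom (suc a) a f +ℚ f (suc a)  ≡⟨ cong (_+ℚ f (suc a)) (sumFrom-empty a f ≤-refl) ⟩
  0ℚ +ℚ f (suc a)                   ≡⟨ ℚ.+-identityˡ (f (suc a)) ⟩
  f (suc a)                         ∎
  where open ≡-Reasoning

sumFrom-convex-≤ : (x : ℕ → ℚ) (k : ℕ) →
  (∀ i → k ≤ i → x (suc i) +ℚ x (suc i) +ℚ x (suc i) ≤ℚ x i +ℚ x (suc (suc i))) →
  ∀ {n} → suc k ≤ n → sumFrom (suc k) n x +ℚ x (suc k) +ℚ x n ≤ℚ x k +ℚ x (suc n)
sumFrom-convex-≤ x k convex = go ∘ ≤⇒≤′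
  where
  open ℚ.≤-Reasoning
  go : ∀ {n} → suc k ≤′ n → sumFrom (suc k) n x +ℚ x (suc k) +ℚ x n ≤ℚ x k +ℚ x (suc n)
  go ≤′-refl = begin
    sumFrom (suc k) (suc k) x +ℚ x (suc k) +ℚ x (suc k)
      ≡⟨ cong (λ s → s +ℚ x (suc k) +ℚ x (suc k)) (sumFrom-single k x) ⟩
    x (suc k) +ℚ x (suc k) +ℚ x (suc k)
      ≤⟨ convex k ≤-refl ⟩
    x k +ℚ x (suc (suc k))                              ∎
  go {suc n} (≤′-step k<′n) = +-cancelʳ-≤ (x n) (begin
    sumFrom (suc k) (suc n) x +ℚ x (suc k) +ℚ x (suc n) +ℚ x n
      ≡⟨ cong (λ s → s +ℚ x (suc k) +ℚ x (suc n) +ℚ x n) (sumFrom-suc n x (m≤n⇒m≤1+n k<n)) ⟩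
    S +ℚ x (suc n) +ℚ x (suc k) +ℚ x (suc n) +ℚ x n
      ≡⟨ solve-+ 4 (λ s a b c → (((s ⊕ c) ⊕ a) ⊕ c) ⊕ b ⊜ ((s ⊕ a) ⊕ b) ⊕ (c ⊕ c))
                   refl S (x (suc k)) (x n) (x (suc n)) ⟩
    S +ℚ x (suc k) +ℚ x n +ℚ (x (suc n) +ℚ x (suc n))
      ≤⟨ ℚ.+-monoˡ-≤ (x (suc n) +ℚ x (suc n)) (go k<′n) ⟩
    x k +ℚ x (suc n) +ℚ (x (suc n) +ℚ x (suc n))
      ≡⟨ solve-+ 2 (λ a c → (a ⊕ c) ⊕ (c ⊕ c) ⊜ a ⊕ ((c ⊕ c) ⊕ c)) refl (x k) (x (suc n)) ⟩
    x k +ℚ (x (suc n) +ℚ x (suc n) +ℚ x (suc n))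
      ≤⟨ ℚ.+-monoʳ-≤ (x k) (convex n (<⇒≤ k<n)) ⟩
    x k +ℚ (x n +ℚ x (suc (suc n)))
      ≡⟨ solve-+ 3 (λ a b d → a ⊕ (b ⊕ d) ⊜ (a ⊕ d) ⊕ b) refl (x k) (x n) (x (suc (suc n))) ⟩
    x k +ℚ x (suc (suc n)) +ℚ x n                        ∎)
    where
    S : ℚ
    S = sumFrom (suc k) n x
    k<n : suc k ≤ n
    k<n = ≤′⇒≤ k<′n

v : ℕ → ℕ
v i = F (suc (2 * i))

F-suc-pos : ∀ m → 0 < F (suc m)
F-suc-pos zero    = s≤s z≤n
F-suc-pos (suc m) = ≤-trans (F-suc-pos m) (m≤m+n _ _)

v-pos : ∀ i → 0 < v i
v-pos i = F-suc-pos (2 * i)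

u-suc : ∀ n → u (suc n) ≡ v n + u n
u-suc n = cong F (*-suc 2 n)

v-suc : ∀ n → v (suc n) ≡ u (suc n) + v n
v-suc n = trans (cong (F ∘ suc) (*-suc 2 n)) (cong (_+ v n) (sym (u-suc n)))

u-suc-pos : ∀ i → 0 < u (suc i)
u-suc-pos i = subst (0 <_) (sym (u-suc i)) (F-suc-pos (suc (2 * i)))

u-pos : ∀ {i} → 0 < i → 0 < u i
u-pos {suc i} _ = u-suc-pos i

-- Each identity below is, in a = u n and b = v n with u (suc n) = b + a, a polynomial
-- identity modulo Cassini's relation b * b = a * u (suc n) + 1.
cassini : ∀ n → v n * v n ≡ u n * u (suc n) + 1
cassini zero = refl
cassini (suc n) rewrite u-suc (suc n) | v-suc n =
  poly-identity (u n) (v n) (u-suc n) (cassini n)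
  where
  poly-identity : ∀ a b {c} → c ≡ b + a → b * b ≡ a * c + 1 →
                  (c + b) * (c + b) ≡ c * (c + b + c) + 1
  poly-identity a b refl h = begin
    (b + a + b) * (b + a + b)                          ≡⟨ solve (a ∷ b ∷ []) ⟩
    a * a + 4 * a * b + 3 * b * b + b * b              ≡⟨ cong (a * a + 4 * a * b + 3 * b * b +_) h ⟩
    a * a + 4 * a * b + 3 * b * b + (a * (b + a) + 1)  ≡⟨ solve (a ∷ b ∷ []) ⟩
    (b + a) * (b + a + b + (b + a)) + 1                ∎
    where open ≡-Reasoning

u-convexity-identity : ∀ n →
  u (suc n) * (u n + u (suc (suc n))) ≡ 3 * (u n * u (suc (suc n))) + 3
u-convexity-identity n rewrite u-suc (suc n) | v-suc n =
  poly-identity (u n) (v n) (u-suc n) (cassini n)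
  where
  poly-identity : ∀ a b {c} → c ≡ b + a → b * b ≡ a * c + 1 →
                  c * (a + (c + b + c)) ≡ 3 * (a * (c + b + c)) + 3
  poly-identity a b refl h = begin
    (b + a) * (a + (b + a + b + (b + a)))          ≡⟨ solve (a ∷ b ∷ []) ⟩
    3 * a * a + 6 * a * b + 3 * (b * b)            ≡⟨ cong (λ x → 3 * a * a + 6 * a * b + 3 * x) h ⟩
    3 * a * a + 6 * a * b + 3 * (a * (b + a) + 1)  ≡⟨ solve (a ∷ b ∷ []) ⟩
    3 * (a * (b + a + b + (b + a))) + 3            ∎
    where open ≡-Reasoning

v-gap-identity : ∀ n → v n * u (suc n) ≡ u n * (v n + u (suc n)) + 1
v-gap-identity n = poly-identity (u n) (v n) (u-suc n) (cassini n)
  where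
  poly-identity : ∀ a b {c} → c ≡ b + a → b * b ≡ a * c + 1 → b * c ≡ a * (b + c) + 1
  poly-identity a b refl h = begin
    b * (b + a)                  ≡⟨ solve (a ∷ b ∷ []) ⟩
    a * b + b * b                ≡⟨ cong (a * b +_) h ⟩
    a * b + (a * (b + a) + 1)    ≡⟨ solve (a ∷ b ∷ []) ⟩
    a * (b + (b + a)) + 1        ∎
    where open ≡-Reasoning

inv-u-convex : ∀ {i} → 0 < i →
  inv (u (suc i)) +ℚ inv (u (suc i)) +ℚ inv (u (suc i)) ≤ℚ inv (u i) +ℚ inv (u (suc (suc i)))
inv-u-convex {i} 0<i = inv-convex (u-pos 0<i) (u-suc-pos i) (u-suc-pos (suc i)) (begin
  3 * (u i * u (suc (suc i)))                ≤⟨ m≤m+n _ 3 ⟩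
  3 * (u i * u (suc (suc i))) + 3            ≡⟨ u-convexity-identity i ⟨
  u (suc i) * (u i + u (suc (suc i)))        ∎)
  where open ℕ.≤-Reasoning

inv-v+inv-u-suc<inv-u : ∀ {n} → 0 < n → inv (v n) +ℚ inv (u (suc n)) <ℚ inv (u n)
inv-v+inv-u-suc<inv-u {n} 0<n = inv-+-inv-< (u-pos 0<n) (v-pos n) (u-suc-pos n)
  (subst (u n * (v n + u (suc n)) <_) (sym (v-gap-identity n)) (m<m+n _ (s≤s z≤n)))

corollary11 : (k n : ℕ) → 1 ≤ k → k + 1 < n →
    ((sumFrom (k + 1) n (λ i → inv (u i)) +ℚ inv (u (k + 1))) +ℚ inv (F (2 * n + 1))) <ℚ inv (u k)
corollary11 k n 0<k k+1<n rewrite +-comm k 1 | +-comm (2 * n) 1 =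
  +-cancelʳ-< (x (suc n)) (begin-strict
    S +ℚ x (suc k) +ℚ inv (v n) +ℚ x (suc n)
      ≡⟨ ℚ.+-assoc (S +ℚ x (suc k)) (inv (v n)) (x (suc n)) ⟩
    S +ℚ x (suc k) +ℚ (inv (v n) +ℚ x (suc n))
      <⟨ ℚ.+-monoʳ-< (S +ℚ x (suc k)) (inv-v+inv-u-suc<inv-u (≤-trans (s≤s z≤n) k<n)) ⟩
    S +ℚ x (suc k) +ℚ x n
      ≤⟨ sumFrom-convex-≤ x k convex k<n ⟩
    x k +ℚ x (suc n) ∎)
  where
  open ℚ.≤-Reasoning
  x : ℕ → ℚ
  x i = inv (u i)
  S : ℚ
  S = sumFrom (suc k) n x
  k<n : suc k ≤ n
  k<n = <⇒≤ k+1<n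
  convex : ∀ i → k ≤ i → x (suc i) +ℚ x (suc i) +ℚ x (suc i) ≤ℚ x i +ℚ x (suc (suc i))
  convex i k≤i = inv-u-convex (≤-trans 0<k k≤i)
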